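{- For any integer $k\geq1$, any $e\in\{0,\ldots,k-1\}$ and any $x\in D_{2k}^e$, we have $f(x)\in D_{2k}^{e+1}$.
   Context: A lattice path with $n$ steps is a sequence $x=(x_1,\ldots,x_n)$ of steps, each either an up-step $(1,1)$ or a down-step $(1,-1)$, drawn in $\mathbb{Z}^2$ starting at the origin. A step lies below the line $y=c$ if both of its endpoints have $y$-coordinate at most $c$. A step touches the line $y=c$ if it starts or ends on that line. For $c\in\mathbb{Z}$, $u_c(x)$ and $d_c(x)$ denote the number of up-steps, respectively down-steps, of $x$ that start on the line $y=c$. Let $L_{2k,k}$ (resp. $L_{2k,k+1}$) be the set of lattice paths with $2k$ steps of which exactly $k$ (resp. $k+1$) are up-steps. $D_{2k}^e$ is the set of paths in $L_{2k,k}$ having exactly $e$ down-steps below the line $y=0$. For $x\in L_{2k,k}\setminus D_{2k}^k$, $g(x)$ is obtained from $x$ by replacing by an up-step the $(d_0(x)+1)$-th (from the left) down-step of $x$ touching the line $y=0$. For $x'\in L_{2k,k+1}$, $h(x')$ is obtained from $x'$ by replacing by a down-step the $u_1(x')$-th (from the left) up-step of $x'$ touching the line $y=1$. $f(x):=h(g(x))$. -}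

module Defs where

open import Data.Bool using (Bool; true; false; _∧_; _∨_; if_then_else_)
open import Data.Nat using (ℕ; zero; suc) renaming (_+_ to _+ℕ_; _*_ to _*ℕ_)
open import Data.Integer using (ℤ; +_; -[1+_]; _+_; _≤?_)
import Data.Integer as ℤ
open import Data.List using (List; []; _∷_; length)
open import Data.Maybe using (Maybe; just; nothing; _>>=_)
import Data.Maybe as Maybe
open import Data.Product using (_×_)
open import Relation.Nullary.Decidable using (⌊_⌋)
open import Relation.Binary.PropositionalEquality using (_≡_)

data Step : Set where
  up down : Step

-- A lattice path is a list of steps, drawn starting at the origin.
Path : Set
Path = List Step

δ : Step → ℤ
δ up = + 1
δ down = -[1+ 0 ]

isUp : Step → Bool
isUp up = true
isUp down = false

isDown : Step → Bool
isDown up = false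
isDown down = true

-- A "step predicate" looks at a step together with the height at which it starts.
StepPred : Set
StepPred = ℤ → Step → Bool

countFrom : StepPred → ℤ → Path → ℕ
countFrom p h [] = 0
countFrom p h (s ∷ xs) =
  (if p h s then 1 else 0) +ℕ countFrom p (h + δ s) xs

count : StepPred → Path → ℕ
count p = countFrom p (+ 0)

_=ℤ_ : ℤ → ℤ → Bool
a =ℤ b = ⌊ a ℤ.≟ b ⌋

_≤ℤ_ : ℤ → ℤ → Bool
a ≤ℤ b = ⌊ a ≤? b ⌋

liesBelow : ℤ → StepPred
liesBelow c h s = (h ≤ℤ c) ∧ ((h + δ s) ≤ℤ c)

touches : ℤ → StepPred
touches c h s = (h =ℤ c) ∨ ((h + δ s) =ℤ c)

u : ℤ → Path → ℕ
u c = count (λ h s → isUp s ∧ (h =ℤ c))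

d : ℤ → Path → ℕ
d c = count (λ h s → isDown s ∧ (h =ℤ c))

numUp : Path → ℕ
numUp = count (λ _ s → isUp s)

downBelow0 : Path → ℕ
downBelow0 = count (λ h s → isDown s ∧ liesBelow (+ 0) h s)

InL : ℕ → ℕ → Path → Set
InL n m x = (length x ≡ n) × (numUp x ≡ m)

InD : ℕ → ℕ → Path → Set
InD k e x = InL (2 *ℕ k) k x × (downBelow0 x ≡ e)

-- Replace by `new` the (i+1)-th (0-based index i) step satisfying p
-- (p evaluated on the ORIGINAL path); nothing if there is no such step.
replaceFrom : StepPred → Step → ℕ → ℤ → Path → Maybe Path
replaceFrom p new i h [] = nothing
replaceFrom p new i h (s ∷ xs) with p h s | i
... | false | _      = Maybe.map (s ∷_) (replaceFrom p new i (h + δ s) xs)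
... | true  | zero   = just (new ∷ xs)
... | true  | suc i' = Maybe.map (s ∷_) (replaceFrom p new i' (h + δ s) xs)

-- Replace the j-th (1-based, from the left) step satisfying p;
-- nothing if j = 0 or there are fewer than j such steps.
replaceKth : StepPred → Step → ℕ → Path → Maybe Path
replaceKth p new zero x = nothing
replaceKth p new (suc i) x = replaceFrom p new i (+ 0) x

g : Path → Maybe Path
g x = replaceKth (λ h s → isDown s ∧ touches (+ 0) h s) up (suc (d (+ 0) x)) x

h : Path → Maybe Path
h x' = replaceKth (λ ht s → isUp s ∧ touches (+ 1) ht s) down (u (+ 1) x') x'

f : Path → Maybe Path
f x = g x >>= h

-- Write x = P ∙ d ∙ S, where d is the down-step that g turns into an up-step; d starts at a
-- height c ∈ {0, 1}. It exists because the down-steps touching y = 0 start at 0 or 1, and a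
-- path from 0 back to 0 has as many down-steps from 1 as up-steps from 0 (both cross the
-- level 1/2), of which there is at least one since otherwise all k down-steps would lie below 0.
-- Counting crossings of the levels 1/2 on P and -1/2 on S shows that u₁(g x) is the number
-- of up-steps of P touching y = 1, so h turns the last of them, u, into a down-step:
-- x = Q ∙ u ∙ R ∙ d ∙ S and f x = Q ∙ d ∙ R ∙ u ∙ S, where R runs from a + 1 (a ∈ {0, 1}) to c
-- without up-steps from 0 or 1. Lowering R by 2 puts exactly its down-steps from heights 1
-- and 2 newly below 0; crossings of the levels 1/2 and 3/2 on R count them, and together with
-- the two exchanged steps f gains exactly one down-step below y = 0.
module Submission where

open import Algebra.Bundles using (AbelianGroup)
open import Data.Bool using (Bool; true; false; _∧_; if_then_else_)
open import Data.Integer using (ℤ; +_; -[1+_]; _+_; _≤?_)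
import Data.Integer as ℤ
import Data.Integer.Properties as ℤ
open import Algebra.Properties.Group (AbelianGroup.group ℤ.+-0-abelianGroup) using (∙-cancelʳ)
open import Data.Integer.Tactic.RingSolver using (solve-∀)
open import Data.List using (_∷_; []; _++_; length)
open import Data.List.Properties using (++-assoc; length-++)
open import Data.Maybe using (just; _>>=_)
open import Data.Nat using (ℕ; zero; suc; _≤_; _<_; z≤n; s≤s) renaming (_+_ to _+ℕ_; _*_ to _*ℕ_)
open import Data.Nat.Properties
  using ( +-assoc; +-comm; +-suc; +-identityʳ; +-cancelˡ-≡; suc-injective; m+n≡0⇒m≡0; m+n≡0⇒n≡0
        ; m<m+n; n<1+n; <-irrefl; +-commutativeSemigroup)
open import Algebra.Properties.CommutativeSemigroup +-commutativeSemigroup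
  using (interchange; x∙yz≈y∙xz; xy∙z≈y∙xz)
open import Data.Nat.Tactic.RingSolver renaming (solve-∀ to solve-∀ℕ)
open import Data.Product using (Σ; _×_; _,_; proj₂)
open import Function using (_∘′_)
open import Level using (Level)
open import Relation.Binary.Definitions using (tri<; tri≈; tri>)
open import Relation.Binary.PropositionalEquality
open import Relation.Nullary using (Dec; yes; no; ¬_)
open import Relation.Nullary.Decidable using (⌊_⌋)
open import Relation.Nullary.Negation using (contradiction)

open import Defs

𝟙 : Bool → ℕ
𝟙 b = if b then 1 else 0

endHeight : ℤ → Path → ℤ
endHeight h []       = h
endHeight h (s ∷ xs) = endHeight (h + δ s) xs

upStep : StepPred
upStep _ = isUp

downStep : StepPred
downStep _ = isDown

upAt : ℤ → StepPred
upAt c h s = isUp s ∧ (h =ℤ c)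

downAt : ℤ → StepPred
downAt c h s = isDown s ∧ (h =ℤ c)

upTouching : ℤ → StepPred
upTouching c h s = isUp s ∧ touches c h s

downTouching : ℤ → StepPred
downTouching c h s = isDown s ∧ touches c h s

downBelow : ℤ → StepPred
downBelow c h s = isDown s ∧ liesBelow c h s

data ZeroOrOne : ℤ → Set where
  is0 : ZeroOrOne (+ 0)
  is1 : ZeroOrOne (+ 1)

module _ {a : Level} {A : Set a} where

  𝟙-yes : (a? : Dec A) → A → 𝟙 ⌊ a? ⌋ ≡ 1
  𝟙-yes (yes _) _  = refl
  𝟙-yes (no ¬a) a  = contradiction a ¬a

  𝟙-no : (a? : Dec A) → ¬ A → 𝟙 ⌊ a? ⌋ ≡ 0
  𝟙-no (yes a) ¬a = contradiction a ¬a
  𝟙-no (no _)  _  = refl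

≤ℤ-split : ∀ h c → 𝟙 (h ≤ℤ c) ≡ 𝟙 ((h + + 1) ≤ℤ c) +ℕ 𝟙 (h =ℤ c)
≤ℤ-split h c rewrite ℤ.+-comm h (+ 1) with ℤ.<-cmp h c
... | tri< h<c h≢c _ = trans (𝟙-yes (h ≤? c) (ℤ.<⇒≤ h<c))
  (sym (cong₂ _+ℕ_ (𝟙-yes (ℤ.suc h ≤? c) (ℤ.i<j⇒suc[i]≤j h<c)) (𝟙-no (h ℤ.≟ c) h≢c)))
... | tri≈ _ refl _ = trans (𝟙-yes (h ≤? h) ℤ.≤-refl)
  (sym (cong₂ _+ℕ_ (𝟙-no (ℤ.suc h ≤? h) (ℤ.<-irrefl refl ∘′ ℤ.suc[i]≤j⇒i<j)) (𝟙-yes (h ℤ.≟ h) refl)))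
... | tri> _ h≢c c<h = trans (𝟙-no (h ≤? c) (ℤ.<⇒≱ c<h))
  (sym (cong₂ _+ℕ_ (𝟙-no (ℤ.suc h ≤? c) (ℤ.<⇒≱ c<h ∘′ ℤ.≤-trans (ℤ.i≤suc[i] h))) (𝟙-no (h ℤ.≟ c) h≢c)))

=ℤ-translate : ∀ t h c → ((h + t) =ℤ (c + t)) ≡ (h =ℤ c)
=ℤ-translate t h c with h + t ℤ.≟ c + t | h ℤ.≟ c
... | yes _      | yes _    = refl
... | no _       | no _     = refl
... | yes h+t≡c+t | no h≢c  = contradiction (∙-cancelʳ t h c h+t≡c+t) h≢c
... | no h+t≢c+t  | yes refl = contradiction refl h+t≢c+t

upAt-translate : ∀ t c h s → upAt (c + t) (h + t) s ≡ upAt c h s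
upAt-translate t c h s = cong (isUp s ∧_) (=ℤ-translate t h c)

countFrom-++ : ∀ p h xs ys → countFrom p h (xs ++ ys) ≡ countFrom p h xs +ℕ countFrom p (endHeight h xs) ys
countFrom-++ p h []       ys = refl
countFrom-++ p h (s ∷ xs) ys =
  trans (cong (𝟙 (p h s) +ℕ_) (countFrom-++ p (h + δ s) xs ys)) (sym (+-assoc (𝟙 (p h s)) _ _))

countFrom-++-suc : ∀ p h xs ys zs → countFrom p (endHeight h xs) ys ≡ suc (countFrom p (endHeight h xs) zs) →
                   countFrom p h (xs ++ ys) ≡ suc (countFrom p h (xs ++ zs))
countFrom-++-suc p h xs ys zs ys≡1+zs = begin
  countFrom p h (xs ++ ys)                                           ≡⟨ countFrom-++ p h xs ys ⟩
  countFrom p h xs +ℕ countFrom p (endHeight h xs) ys                ≡⟨ cong (countFrom p h xs +ℕ_) ys≡1+zs ⟩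
  countFrom p h xs +ℕ suc (countFrom p (endHeight h xs) zs)          ≡⟨ +-suc _ _ ⟩
  suc (countFrom p h xs +ℕ countFrom p (endHeight h xs) zs)          ≡⟨ cong suc (countFrom-++ p h xs zs) ⟨
  suc (countFrom p h (xs ++ zs))                                     ∎
  where open ≡-Reasoning

endHeight-++ : ∀ h xs ys → endHeight h (xs ++ ys) ≡ endHeight (endHeight h xs) ys
endHeight-++ h []       ys = refl
endHeight-++ h (s ∷ xs) ys = endHeight-++ (h + δ s) xs ys

countFrom-sum : ∀ {p q r} → (∀ h s → 𝟙 (p h s) ≡ 𝟙 (q h s) +ℕ 𝟙 (r h s)) →
                ∀ h xs → countFrom p h xs ≡ countFrom q h xs +ℕ countFrom r h xs
countFrom-sum p≡q+r h []       = refl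
countFrom-sum {q = q} {r} p≡q+r h (s ∷ xs) =
  trans (cong₂ _+ℕ_ (p≡q+r h s) (countFrom-sum p≡q+r (h + δ s) xs))
        (interchange (𝟙 (q h s)) (𝟙 (r h s)) (countFrom q (h + δ s) xs) (countFrom r (h + δ s) xs))

[i+j]+k≡[i+k]+j : ∀ i j k → (i + j) + k ≡ (i + k) + j
[i+j]+k≡[i+k]+j = solve-∀

countFrom-translate : ∀ {p q} t → (∀ h s → p (h + t) s ≡ q h s) →
                      ∀ h xs → countFrom p (h + t) xs ≡ countFrom q h xs
countFrom-translate t p≡q h []       = refl
countFrom-translate t p≡q h (s ∷ xs) = cong₂ (λ b n → 𝟙 b +ℕ n) (p≡q h s)
  (trans (cong (λ h′ → countFrom _ h′ xs) ([i+j]+k≡[i+k]+j h t (δ s))) (countFrom-translate t p≡q (h + δ s) xs))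

endHeight-translate : ∀ t h xs → endHeight (h + t) xs ≡ endHeight h xs + t
endHeight-translate t h []       = refl
endHeight-translate t h (s ∷ xs) =
  trans (cong (λ h′ → endHeight h′ xs) ([i+j]+k≡[i+k]+j h t (δ s))) (endHeight-translate t (h + δ s) xs)

countFrom-telescope : (φ : ℤ → ℕ) {p q : StepPred} →
  (∀ h s → φ h +ℕ 𝟙 (p h s) ≡ φ (h + δ s) +ℕ 𝟙 (q h s)) →
  ∀ h xs → φ h +ℕ countFrom p h xs ≡ φ (endHeight h xs) +ℕ countFrom q h xs
countFrom-telescope φ step h []       = refl
countFrom-telescope φ {p} {q} step h (s ∷ xs) = begin
  φ h +ℕ (𝟙 (p h s) +ℕ P)                 ≡⟨ +-assoc (φ h) _ _ ⟨
  (φ h +ℕ 𝟙 (p h s)) +ℕ P                 ≡⟨ cong (_+ℕ P) (step h s) ⟩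
  (φ h′ +ℕ 𝟙 (q h s)) +ℕ P                ≡⟨ xy∙z≈y∙xz (φ h′) (𝟙 (q h s)) P ⟩
  𝟙 (q h s) +ℕ (φ h′ +ℕ P)                ≡⟨ cong (𝟙 (q h s) +ℕ_) (countFrom-telescope φ step h′ xs) ⟩
  𝟙 (q h s) +ℕ (φ (endHeight h′ xs) +ℕ Q) ≡⟨ x∙yz≈y∙xz (𝟙 (q h s)) (φ (endHeight h′ xs)) Q ⟩
  φ (endHeight h′ xs) +ℕ (𝟙 (q h s) +ℕ Q) ∎
  where
  open ≡-Reasoning
  h′ = h + δ s
  P = countFrom p h′ xs
  Q = countFrom q h′ xs

-- Crossings of a horizontal level

crossing-step : ∀ c h s →
  𝟙 (h ≤ℤ c) +ℕ 𝟙 (downAt (c + + 1) h s) ≡ 𝟙 ((h + δ s) ≤ℤ c) +ℕ 𝟙 (upAt c h s)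
crossing-step c h up   = trans (+-identityʳ _) (≤ℤ-split h c)
crossing-step c h down = begin
  𝟙 (h ≤ℤ c) +ℕ 𝟙 (h =ℤ (c + + 1))
    ≡⟨ cong (λ h″ → 𝟙 (h″ ≤ℤ c) +ℕ 𝟙 (h″ =ℤ (c + + 1))) h′+1≡h ⟨
  𝟙 ((h′ + + 1) ≤ℤ c) +ℕ 𝟙 ((h′ + + 1) =ℤ (c + + 1))
    ≡⟨ cong (λ b → 𝟙 ((h′ + + 1) ≤ℤ c) +ℕ 𝟙 b) (=ℤ-translate (+ 1) h′ c) ⟩
  𝟙 ((h′ + + 1) ≤ℤ c) +ℕ 𝟙 (h′ =ℤ c)
    ≡⟨ ≤ℤ-split h′ c ⟨
  𝟙 (h′ ≤ℤ c)
    ≡⟨ +-identityʳ _ ⟨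
  𝟙 (h′ ≤ℤ c) +ℕ 0 ∎
  where
  open ≡-Reasoning
  h′ = h + -[1+ 0 ]
  h′+1≡h : h′ + + 1 ≡ h
  h′+1≡h = trans (ℤ.+-assoc h -[1+ 0 ] (+ 1)) (ℤ.+-identityʳ h)

-- An up-step from c and a down-step from c + 1 cross the level c + 1/2 in opposite directions.
crossings : ∀ c h xs →
  𝟙 (h ≤ℤ c) +ℕ countFrom (downAt (c + + 1)) h xs ≡ 𝟙 (endHeight h xs ≤ℤ c) +ℕ countFrom (upAt c) h xs
crossings c = countFrom-telescope (λ h → 𝟙 (h ≤ℤ c)) (crossing-step c)

downTouching0-split : ∀ h s → 𝟙 (downTouching (+ 0) h s) ≡ 𝟙 (downAt (+ 0) h s) +ℕ 𝟙 (downAt (+ 1) h s)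
downTouching0-split h               up   = refl
downTouching0-split (+ 0)           down = refl
downTouching0-split (+ 1)           down = refl
downTouching0-split (+ suc (suc n)) down = refl
downTouching0-split -[1+ n ]        down = refl

upTouching1-split : ∀ h s → 𝟙 (upTouching (+ 1) h s) ≡ 𝟙 (upAt (+ 1) h s) +ℕ 𝟙 (upAt (+ 0) h s)
upTouching1-split h               down = refl
upTouching1-split (+ 0)           up   = refl
upTouching1-split (+ 1)           up   = refl
upTouching1-split (+ suc (suc n)) up   = refl
upTouching1-split -[1+ 0 ]        up   = refl
upTouching1-split -[1+ suc n ]    up   = refl

downTouching0-true : ∀ h s → downTouching (+ 0) h s ≡ true → s ≡ down × ZeroOrOne h
downTouching0-true (+ 0)           down _ = refl , is0
downTouching0-true (+ 1)           down _ = refl , is1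
downTouching0-true (+ suc (suc n)) down ()
downTouching0-true -[1+ n ]        down ()
downTouching0-true h               up   ()

upTouching1-true : ∀ h s → upTouching (+ 1) h s ≡ true → s ≡ up × ZeroOrOne h
upTouching1-true (+ 0)           up _ = refl , is0
upTouching1-true (+ 1)           up _ = refl , is1
upTouching1-true (+ suc (suc n)) up ()
upTouching1-true -[1+ 0 ]        up ()
upTouching1-true -[1+ suc n ]    up ()
upTouching1-true h               down ()

downBelow1-split : ∀ h s → 𝟙 (downBelow (+ 1) h s) ≡ 𝟙 (downBelow (+ 0) h s) +ℕ 𝟙 (downAt (+ 1) h s)
downBelow1-split h               up   = refl
downBelow1-split (+ 0)           down = refl
downBelow1-split (+ 1)           down = refl
downBelow1-split (+ suc (suc n)) down = refl
downBelow1-split -[1+ n ]        down = refl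

downBelow0-lowered : ∀ h s → 𝟙 (downBelow (+ 0) (h + -[1+ 1 ]) s) ≡ 𝟙 (downBelow (+ 1) h s) +ℕ 𝟙 (downAt (+ 2) h s)
downBelow0-lowered h                     up   = refl
downBelow0-lowered (+ 0)                 down = refl
downBelow0-lowered (+ 1)                 down = refl
downBelow0-lowered (+ 2)                 down = refl
downBelow0-lowered (+ suc (suc (suc n))) down = refl
downBelow0-lowered -[1+ n ]              down = refl

-- Paths in L_{2k,k}

numUp+numDown : ∀ h xs → countFrom upStep h xs +ℕ countFrom downStep h xs ≡ length xs
numUp+numDown h []          = refl
numUp+numDown h (up ∷ xs)   = cong suc (numUp+numDown _ xs)
numUp+numDown h (down ∷ xs) = trans (+-suc _ _) (cong suc (numUp+numDown _ xs))

endHeight-balance : ∀ h xs → endHeight h xs + + countFrom downStep h xs ≡ h + + countFrom upStep h xs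
endHeight-balance h []          = refl
endHeight-balance h (up ∷ xs)   = trans (endHeight-balance (h + + 1) xs) (ℤ.+-assoc h (+ 1) _)
endHeight-balance h (down ∷ xs) = begin
  E + (+ 1 + + D)                ≡⟨ i+[1+j]≡[i+j]+1 E (+ D) ⟩
  (E + + D) + + 1                ≡⟨ cong (_+ + 1) (endHeight-balance (h + -[1+ 0 ]) xs) ⟩
  ((h + -[1+ 0 ]) + + U) + + 1   ≡⟨ uni+[1+j]≡[i+j]+1 h (+ U) ⟩
  h + + U                        ∎
  where
  open ≡-Reasoning
  E = endHeight (h + -[1+ 0 ]) xs
  D = countFrom downStep (h + -[1+ 0 ]) xs
  U = countFrom upStep (h + -[1+ 0 ]) xs
  i+[1+j]≡[i+j]+1 : ∀ i j → i + (+ 1 + j) ≡ (i + j) + + 1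
  i+[1+j]≡[i+j]+1 = solve-∀
  uni+[1+j]≡[i+j]+1 : ∀ a b → ((a + -[1+ 0 ]) + b) + + 1 ≡ a + b
  uni+[1+j]≡[i+j]+1 = solve-∀

InL-numDown : ∀ {k} x → InL (2 *ℕ k) k x → countFrom downStep (+ 0) x ≡ k
InL-numDown {k} x (len , nu) = +-cancelˡ-≡ k _ _ (begin
  k +ℕ countFrom downStep (+ 0) x         ≡⟨ cong (_+ℕ _) nu ⟨
  numUp x +ℕ countFrom downStep (+ 0) x   ≡⟨ numUp+numDown (+ 0) x ⟩
  length x                                ≡⟨ len ⟩
  k +ℕ (k +ℕ 0)                           ≡⟨ cong (k +ℕ_) (+-identityʳ k) ⟩
  k +ℕ k                                  ∎)
  where open ≡-Reasoning

InL-endHeight : ∀ {k} x → InL (2 *ℕ k) k x → endHeight (+ 0) x ≡ + 0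
InL-endHeight {k} x x∈L = ∙-cancelʳ (+ k) _ _ (begin
  endHeight (+ 0) x + + k                          ≡⟨ cong (λ n → endHeight (+ 0) x + + n) (InL-numDown x x∈L) ⟨
  endHeight (+ 0) x + + countFrom downStep (+ 0) x ≡⟨ endHeight-balance (+ 0) x ⟩
  + 0 + + numUp x                                  ≡⟨ cong (λ n → + 0 + + n) (proj₂ x∈L) ⟩
  + 0 + + k                                        ∎)
  where open ≡-Reasoning

numUp-heightFree : ∀ h h′ xs → countFrom upStep h xs ≡ countFrom upStep h′ xs
numUp-heightFree h h′ []          = refl
numUp-heightFree h h′ (up ∷ xs)   = cong suc (numUp-heightFree _ _ xs)
numUp-heightFree h h′ (down ∷ xs) = numUp-heightFree _ _ xs

numUp-flip : ∀ h pre post → countFrom upStep h (pre ++ up ∷ post) ≡ suc (countFrom upStep h (pre ++ down ∷ post))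
numUp-flip h []           post = cong suc (numUp-heightFree _ _ post)
numUp-flip h (up ∷ pre)   post = cong suc (numUp-flip _ pre post)
numUp-flip h (down ∷ pre) post = numUp-flip _ pre post

InL-exchange : ∀ {n m} Q R S → InL n m (Q ++ up ∷ (R ++ down ∷ S)) → InL n m (Q ++ down ∷ (R ++ up ∷ S))
InL-exchange Q R S (len , nu) = trans sameLength len , suc-injective (begin
  suc (numUp (Q ++ down ∷ (R ++ up ∷ S)))  ≡⟨ numUp-flip (+ 0) Q (R ++ up ∷ S) ⟨
  numUp (Q ++ up ∷ (R ++ up ∷ S))          ≡⟨ cong numUp (++-assoc Q (up ∷ R) (up ∷ S)) ⟨
  numUp ((Q ++ up ∷ R) ++ up ∷ S)          ≡⟨ numUp-flip (+ 0) (Q ++ up ∷ R) S ⟩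
  suc (numUp ((Q ++ up ∷ R) ++ down ∷ S))  ≡⟨ cong (suc ∘′ numUp) (++-assoc Q (up ∷ R) (down ∷ S)) ⟩
  suc (numUp (Q ++ up ∷ (R ++ down ∷ S)))  ≡⟨ cong suc nu ⟩
  suc _                                    ∎)
  where
  open ≡-Reasoning
  sameLength : length (Q ++ down ∷ (R ++ up ∷ S)) ≡ length (Q ++ up ∷ (R ++ down ∷ S))
  sameLength = trans (length-++ Q) (trans
    (cong (λ n → length Q +ℕ suc n) (trans (length-++ R {up ∷ S}) (sym (length-++ R {down ∷ S}))))
    (sym (length-++ Q)))

stays-below-0 : ∀ {h} xs → h ℤ.≤ + 0 → countFrom (upAt (+ 0)) h xs ≡ 0 →
                countFrom (downBelow (+ 0)) h xs ≡ countFrom downStep h xs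
stays-below-0 {+ suc _}       _           (ℤ.+≤+ ()) _
stays-below-0                 []          _ _    = refl
stays-below-0 {+ 0}           (up ∷ xs)   _ ()
stays-below-0 {+ 0}           (down ∷ xs) _ none = cong suc (stays-below-0 xs ℤ.-≤+ none)
stays-below-0 { -[1+ 0 ]}     (up ∷ xs)   _ none = stays-below-0 xs ℤ.≤-refl none
stays-below-0 { -[1+ suc n ]} (up ∷ xs)   _ none = stays-below-0 xs ℤ.-≤+ none
stays-below-0 { -[1+ n ]}     (down ∷ xs) _ none = cong suc (stays-below-0 xs ℤ.-≤+ none)

record Occurrence (p : StepPred) (h : ℤ) (xs : Path) (i : ℕ) : Set where
  constructor occurrence
  field
    before : Path
    step   : Step
    after  : Path
    split  : xs ≡ before ++ step ∷ after
    index  : countFrom p h before ≡ i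
    holds  : p (endHeight h before) step ≡ true

nth-occurrence : ∀ p h xs i → i < countFrom p h xs → Occurrence p h xs i
nth-occurrence p h (s ∷ xs) i i< with p h s in ps
nth-occurrence p h (s ∷ xs) zero    _        | true = occurrence [] s xs refl refl ps
nth-occurrence p h (s ∷ xs) (suc i) (s≤s i<) | true
  with occurrence pre s′ post refl refl ok ← nth-occurrence p (h + δ s) xs i i<
  = occurrence (s ∷ pre) s′ post refl (cong (λ b → 𝟙 b +ℕ countFrom p (h + δ s) pre) ps) ok
nth-occurrence p h (s ∷ xs) i       i<       | false
  with occurrence pre s′ post refl refl ok ← nth-occurrence p (h + δ s) xs i i<
  = occurrence (s ∷ pre) s′ post refl (cong (λ b → 𝟙 b +ℕ countFrom p (h + δ s) pre) ps) ok

occurrence-++ : ∀ {p h xs i} ys → Occurrence p h xs i → Occurrence p h (xs ++ ys) i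
occurrence-++ ys (occurrence pre s post refl count ok) =
  occurrence pre s (post ++ ys) (++-assoc pre (s ∷ post) ys) count ok

countFrom-after-last : ∀ {p h xs m} (o : Occurrence p h xs m) → countFrom p h xs ≡ suc m →
  let open Occurrence o in countFrom p (endHeight h before + δ step) after ≡ 0
countFrom-after-last {p} {h} {m = m} (occurrence pre s post refl refl ok) total =
  suc-injective (+-cancelˡ-≡ m _ 1 (begin
    m +ℕ suc rest                                     ≡⟨ cong (λ b → m +ℕ (𝟙 b +ℕ rest)) ok ⟨
    m +ℕ countFrom p (endHeight h pre) (s ∷ post)     ≡⟨ countFrom-++ p h pre (s ∷ post) ⟨
    countFrom p h (pre ++ s ∷ post)                   ≡⟨ total ⟩
    suc m                                             ≡⟨ +-comm m 1 ⟨
    m +ℕ 1                                            ∎))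
  where
  open ≡-Reasoning
  rest = countFrom p (endHeight h pre + δ s) post

replaceFrom-at : ∀ p new h pre s post → p (endHeight h pre) s ≡ true →
  replaceFrom p new (countFrom p h pre) h (pre ++ s ∷ post) ≡ just (pre ++ new ∷ post)
replaceFrom-at p new h []        s post ok rewrite ok = refl
replaceFrom-at p new h (t ∷ pre) s post ok with p h t
... | false rewrite replaceFrom-at p new (h + δ t) pre s post ok = refl
... | true  rewrite replaceFrom-at p new (h + δ t) pre s post ok = refl

replace-occurrence : ∀ {p h xs i} new (o : Occurrence p h xs i) →
  let open Occurrence o in replaceFrom p new i h xs ≡ just (before ++ new ∷ after)
replace-occurrence new (occurrence pre s post refl refl ok) = replaceFrom-at _ new _ pre s post ok

-- The map f on D_{2k}^e

ups-from-0-positive : ∀ {k e} x → e < k → InD k e x → 0 < countFrom (upAt (+ 0)) (+ 0) x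
ups-from-0-positive x e<k (x∈L , below) with countFrom (upAt (+ 0)) (+ 0) x in none
... | suc _ = s≤s z≤n
... | zero  = contradiction e<k (<-irrefl e≡k)
  where
  e≡k = trans (sym below) (trans (stays-below-0 x (ℤ.+≤+ z≤n) none) (InL-numDown x x∈L))

g-index-bound : ∀ {k e} x → e < k → InD k e x → d (+ 0) x < countFrom (downTouching (+ 0)) (+ 0) x
g-index-bound x e<k x∈D@(x∈L , _) =
  subst (d (+ 0) x <_) (sym (countFrom-sum downTouching0-split (+ 0) x))
    (m<m+n (d (+ 0) x) (subst (0 <_) (sym downs₁≡ups₀) (ups-from-0-positive x e<k x∈D)))
  where
  downs₁≡ups₀ : countFrom (downAt (+ 1)) (+ 0) x ≡ countFrom (upAt (+ 0)) (+ 0) x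
  downs₁≡ups₀ = suc-injective (trans (crossings (+ 0) (+ 0) x)
    (cong (λ h → 𝟙 (h ≤ℤ (+ 0)) +ℕ countFrom (upAt (+ 0)) (+ 0) x) (InL-endHeight x x∈L)))

-- The u₁(g x)-th up-step of g x touching y = 1 is the last such step before the modified one.
u₁-after-g : ∀ {k} P S {c} → ZeroOrOne c → endHeight (+ 0) P ≡ c →
  countFrom (downTouching (+ 0)) (+ 0) P ≡ d (+ 0) (P ++ down ∷ S) → InL (2 *ℕ k) k (P ++ down ∷ S) →
  Σ ℕ λ m → countFrom (upTouching (+ 1)) (+ 0) P ≡ suc m × u (+ 1) (P ++ up ∷ S) ≡ suc m
u₁-after-g P S {c} c∈01 eP index x∈L = U1P +ℕ D0S , touchingP , u₁x′
  where
  open ≡-Reasoning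
  D0P = countFrom (downAt (+ 0)) (+ 0) P
  D1P = countFrom (downAt (+ 1)) (+ 0) P
  U0P = countFrom (upAt (+ 0)) (+ 0) P
  U1P = countFrom (upAt (+ 1)) (+ 0) P
  D0S = countFrom (downAt (+ 0)) (c + -[1+ 0 ]) S
  U₋₁S = countFrom (upAt -[1+ 0 ]) (c + -[1+ 0 ]) S
  U1S′ = countFrom (upAt (+ 1)) (c + + 1) S

  eS : endHeight (c + -[1+ 0 ]) S ≡ + 0
  eS = trans (sym (trans (endHeight-++ (+ 0) P (down ∷ S)) (cong (λ h → endHeight (h + -[1+ 0 ]) S) eP)))
             (InL-endHeight (P ++ down ∷ S) x∈L)

  D1P≡ : D1P ≡ 𝟙 (downAt (+ 0) c down) +ℕ D0S
  D1P≡ = +-cancelˡ-≡ D0P _ _ (begin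
    D0P +ℕ D1P                                                       ≡⟨ countFrom-sum downTouching0-split (+ 0) P ⟨
    countFrom (downTouching (+ 0)) (+ 0) P                           ≡⟨ index ⟩
    d (+ 0) (P ++ down ∷ S)                                          ≡⟨ countFrom-++ (downAt (+ 0)) (+ 0) P (down ∷ S) ⟩
    D0P +ℕ countFrom (downAt (+ 0)) (endHeight (+ 0) P) (down ∷ S)   ≡⟨ cong (λ h → D0P +ℕ countFrom (downAt (+ 0)) h (down ∷ S)) eP ⟩
    D0P +ℕ (𝟙 (downAt (+ 0) c down) +ℕ D0S)                          ∎)

  crossingsP : suc D1P ≡ 𝟙 (c ≤ℤ (+ 0)) +ℕ U0P
  crossingsP = trans (crossings (+ 0) (+ 0) P) (cong (λ h → 𝟙 (h ≤ℤ (+ 0)) +ℕ U0P) eP)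

  crossingsS : 𝟙 ((c + -[1+ 0 ]) ≤ℤ -[1+ 0 ]) +ℕ D0S ≡ U₋₁S
  crossingsS = trans (crossings -[1+ 0 ] (c + -[1+ 0 ]) S) (cong (λ h → 𝟙 (h ≤ℤ -[1+ 0 ]) +ℕ U₋₁S) eS)

  U1S′≡U₋₁S : U1S′ ≡ U₋₁S
  U1S′≡U₋₁S = trans (cong (λ h → countFrom (upAt (+ 1)) h S) (sym (ℤ.+-assoc c -[1+ 0 ] (+ 2))))
                    (countFrom-translate (+ 2) (upAt-translate (+ 2) -[1+ 0 ]) (c + -[1+ 0 ]) S)

  U0P≡ : ZeroOrOne c → U0P ≡ suc D0S
  U0P≡ is0 = trans (sym (suc-injective crossingsP)) D1P≡
  U0P≡ is1 = trans (sym crossingsP) (cong suc D1P≡)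

  ups₁-after≡ : ZeroOrOne c → 𝟙 (upAt (+ 1) c up) +ℕ U1S′ ≡ suc D0S
  ups₁-after≡ is0 = trans U1S′≡U₋₁S (sym crossingsS)
  ups₁-after≡ is1 = cong suc (trans U1S′≡U₋₁S (sym crossingsS))

  touchingP : countFrom (upTouching (+ 1)) (+ 0) P ≡ suc (U1P +ℕ D0S)
  touchingP = trans (countFrom-sum upTouching1-split (+ 0) P) (trans (cong (U1P +ℕ_) (U0P≡ c∈01)) (+-suc U1P D0S))

  u₁x′ : u (+ 1) (P ++ up ∷ S) ≡ suc (U1P +ℕ D0S)
  u₁x′ = begin
    u (+ 1) (P ++ up ∷ S)                                          ≡⟨ countFrom-++ (upAt (+ 1)) (+ 0) P (up ∷ S) ⟩
    U1P +ℕ countFrom (upAt (+ 1)) (endHeight (+ 0) P) (up ∷ S)     ≡⟨ cong (λ h → U1P +ℕ countFrom (upAt (+ 1)) h (up ∷ S)) eP ⟩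
    U1P +ℕ (𝟙 (upAt (+ 1) c up) +ℕ U1S′)                           ≡⟨ cong (U1P +ℕ_) (ups₁-after≡ c∈01) ⟩
    U1P +ℕ suc D0S                                                 ≡⟨ +-suc U1P D0S ⟩
    suc (U1P +ℕ D0S)                                               ∎

downBelow0-exchange : ∀ R S {a c} → ZeroOrOne a → ZeroOrOne c → endHeight (a + + 1) R ≡ c →
  countFrom (upTouching (+ 1)) (a + + 1) R ≡ 0 →
  countFrom (downBelow (+ 0)) a (down ∷ (R ++ up ∷ S)) ≡ suc (countFrom (downBelow (+ 0)) a (up ∷ (R ++ down ∷ S)))
downBelow0-exchange R S {a} {c} a∈01 c∈01 eR untouched = begin
  𝟙 (DB a down) +ℕ countFrom DB (a + -[1+ 0 ]) (R ++ up ∷ S)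
    ≡⟨ cong (𝟙 (DB a down) +ℕ_) (countFrom-++ DB (a + -[1+ 0 ]) R (up ∷ S)) ⟩
  𝟙 (DB a down) +ℕ (countFrom DB (a + -[1+ 0 ]) R +ℕ countFrom DB (endHeight (a + -[1+ 0 ]) R + + 1) S)
    ≡⟨ cong₂ (λ m n → 𝟙 (DB a down) +ℕ (m +ℕ n)) lowered-R lowered-S ⟩
  𝟙 (DB a down) +ℕ (((DBR +ℕ D1R) +ℕ D2R) +ℕ DBS)
    ≡⟨ regroup (𝟙 (DB a down)) DBR D1R D2R DBS ⟩
  (𝟙 (DB a down) +ℕ (D1R +ℕ D2R)) +ℕ (DBR +ℕ DBS)
    ≡⟨ cong (_+ℕ (DBR +ℕ DBS)) (shifted-downs a∈01 c∈01) ⟩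
  suc (𝟙 (DB c down)) +ℕ (DBR +ℕ DBS)
    ≡⟨ cong suc (x∙yz≈y∙xz (𝟙 (DB c down)) DBR DBS) ⟩
  suc (DBR +ℕ (𝟙 (DB c down) +ℕ DBS))
    ≡⟨ cong (λ h → suc (DBR +ℕ countFrom DB h (down ∷ S))) eR ⟨
  suc (DBR +ℕ countFrom DB (endHeight (a + + 1) R) (down ∷ S))
    ≡⟨ cong suc (countFrom-++ DB (a + + 1) R (down ∷ S)) ⟨
  suc (countFrom DB (a + + 1) (R ++ down ∷ S)) ∎
  where
  open ≡-Reasoning
  DB  = downBelow (+ 0)
  DBR = countFrom DB (a + + 1) R
  D1R = countFrom (downAt (+ 1)) (a + + 1) R
  D2R = countFrom (downAt (+ 2)) (a + + 1) R
  DBS = countFrom DB (c + -[1+ 0 ]) S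

  regroup : ∀ x r d₁ d₂ s → x +ℕ (((r +ℕ d₁) +ℕ d₂) +ℕ s) ≡ (x +ℕ (d₁ +ℕ d₂)) +ℕ (r +ℕ s)
  regroup = solve-∀ℕ

  a-1≡a+1-2 : a + -[1+ 0 ] ≡ (a + + 1) + -[1+ 1 ]
  a-1≡a+1-2 = sym (ℤ.+-assoc a (+ 1) -[1+ 1 ])

  lowered-R : countFrom DB (a + -[1+ 0 ]) R ≡ (DBR +ℕ D1R) +ℕ D2R
  lowered-R = begin
    countFrom DB (a + -[1+ 0 ]) R                                ≡⟨ cong (λ h → countFrom DB h R) a-1≡a+1-2 ⟩
    countFrom DB ((a + + 1) + -[1+ 1 ]) R                        ≡⟨ countFrom-translate -[1+ 1 ] (λ _ _ → refl) (a + + 1) R ⟩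
    countFrom (λ h → DB (h + -[1+ 1 ])) (a + + 1) R              ≡⟨ countFrom-sum downBelow0-lowered (a + + 1) R ⟩
    countFrom (downBelow (+ 1)) (a + + 1) R +ℕ D2R               ≡⟨ cong (_+ℕ D2R) (countFrom-sum downBelow1-split (a + + 1) R) ⟩
    (DBR +ℕ D1R) +ℕ D2R                                          ∎

  lowered-S : countFrom DB (endHeight (a + -[1+ 0 ]) R + + 1) S ≡ DBS
  lowered-S = cong (λ h → countFrom DB h S) (begin
    endHeight (a + -[1+ 0 ]) R + + 1                ≡⟨ cong (λ h → endHeight h R + + 1) a-1≡a+1-2 ⟩
    endHeight ((a + + 1) + -[1+ 1 ]) R + + 1        ≡⟨ cong (_+ + 1) (endHeight-translate -[1+ 1 ] (a + + 1) R) ⟩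
    (endHeight (a + + 1) R + -[1+ 1 ]) + + 1        ≡⟨ cong (λ h → (h + -[1+ 1 ]) + + 1) eR ⟩
    (c + -[1+ 1 ]) + + 1                            ≡⟨ ℤ.+-assoc c -[1+ 1 ] (+ 1) ⟩
    c + -[1+ 0 ]                                    ∎)

  U1R+U0R≡0 : countFrom (upAt (+ 1)) (a + + 1) R +ℕ countFrom (upAt (+ 0)) (a + + 1) R ≡ 0
  U1R+U0R≡0 = trans (sym (countFrom-sum upTouching1-split (a + + 1) R)) untouched

  crossings₀ : 𝟙 ((a + + 1) ≤ℤ (+ 0)) +ℕ D1R ≡ 𝟙 (c ≤ℤ (+ 0))
  crossings₀ = trans (crossings (+ 0) (a + + 1) R)
    (trans (cong₂ (λ h n → 𝟙 (h ≤ℤ (+ 0)) +ℕ n) eR (m+n≡0⇒n≡0 _ U1R+U0R≡0)) (+-identityʳ _))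

  crossings₁ : 𝟙 ((a + + 1) ≤ℤ (+ 1)) +ℕ D2R ≡ 𝟙 (c ≤ℤ (+ 1))
  crossings₁ = trans (crossings (+ 1) (a + + 1) R)
    (trans (cong₂ (λ h n → 𝟙 (h ≤ℤ (+ 1)) +ℕ n) eR (m+n≡0⇒m≡0 _ U1R+U0R≡0)) (+-identityʳ _))

  shifted-downs : ZeroOrOne a → ZeroOrOne c → 𝟙 (DB a down) +ℕ (D1R +ℕ D2R) ≡ suc (𝟙 (DB c down))
  shifted-downs is0 is0 = cong₂ (λ m n → 1 +ℕ (m +ℕ n)) crossings₀ (suc-injective crossings₁)
  shifted-downs is0 is1 = cong₂ (λ m n → 1 +ℕ (m +ℕ n)) crossings₀ (suc-injective crossings₁)
  shifted-downs is1 is0 = cong₂ _+ℕ_ crossings₀ crossings₁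
  shifted-downs is1 is1 = cong₂ _+ℕ_ crossings₀ crossings₁

f-after-g : ∀ {k e} P S {c} → ZeroOrOne c → endHeight (+ 0) P ≡ c →
  countFrom (downTouching (+ 0)) (+ 0) P ≡ d (+ 0) (P ++ down ∷ S) →
  g (P ++ down ∷ S) ≡ just (P ++ up ∷ S) → InD k e (P ++ down ∷ S) →
  Σ Path λ y → (f (P ++ down ∷ S) ≡ just y) × InD k (suc e) y
f-after-g P S c∈01 eP index gx (x∈L , below)
  with m , touchingP , u₁x′ ← u₁-after-g P S c∈01 eP index x∈L
  with o@(occurrence Q s R refl _ touch)
         ← nth-occurrence (upTouching (+ 1)) (+ 0) P m (subst (m <_) (sym touchingP) (n<1+n m))
  with refl , a∈01 ← upTouching1-true (endHeight (+ 0) Q) s touch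
  = Q ++ down ∷ (R ++ up ∷ S) , trans (cong (_>>= h) gx) hx′ , InL-exchange Q R S x∈L′ , below′
  where
  reassoc : (Q ++ up ∷ R) ++ down ∷ S ≡ Q ++ up ∷ (R ++ down ∷ S)
  reassoc = ++-assoc Q (up ∷ R) (down ∷ S)

  hx′ : h ((Q ++ up ∷ R) ++ up ∷ S) ≡ just (Q ++ down ∷ (R ++ up ∷ S))
  hx′ = trans (cong (λ j → replaceKth (upTouching (+ 1)) down j ((Q ++ up ∷ R) ++ up ∷ S)) u₁x′)
              (replace-occurrence down (occurrence-++ (up ∷ S) o))

  x∈L′ : InL _ _ (Q ++ up ∷ (R ++ down ∷ S))
  x∈L′ = subst (InL _ _) reassoc x∈L

  below′ : downBelow0 (Q ++ down ∷ (R ++ up ∷ S)) ≡ suc _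
  below′ = trans
    (countFrom-++-suc (downBelow (+ 0)) (+ 0) Q _ _
      (downBelow0-exchange R S a∈01 c∈01 (trans (sym (endHeight-++ (+ 0) Q (up ∷ R))) eP) (countFrom-after-last o touchingP)))
    (cong suc (trans (cong downBelow0 (sym reassoc)) below))

lemma10 : (k e : ℕ) → 1 ≤ k → e < k → (x : Path) → InD k e x →
            Σ Path (λ y → (f x ≡ just y) × InD k (suc e) y)
lemma10 k e _ e<k x x∈D
  with o@(occurrence P s S refl index touch)
         ← nth-occurrence (downTouching (+ 0)) (+ 0) x (d (+ 0) x) (g-index-bound x e<k x∈D)
  with refl , c∈01 ← downTouching0-true (endHeight (+ 0) P) s touch
  = f-after-g P S c∈01 refl index (replace-occurrence up o) x∈D
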